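{- Let $l\ge2$, let $j\in\mathbb{Z}$, and let $(\lambda,j)$ be a $j$-core abacus of type $C_l^{(1)}$. Then: (1) if position $i$ carries a bead, there is no integer $m<i$ such that the $2l$ positions $m,m-1,\dots,m+1-2l$ are all empty; (2) if position $i$ is empty, there is no integer $m>i$ such that the $2l$ positions $m,m+1,\dots,m-1+2l$ all carry a bead.
   Context: For a partition $\lambda$ and an integer $j$ (the charge), the abacus $(\lambda,j)$ is the set $\beta_j(\lambda)=\{\lambda_i-i+j: i\ge1\}\subseteq\mathbb{Z}$. Position $x\in\mathbb{Z}$ carries a bead iff $x\in\beta_j(\lambda)$. For $0\le i\le l$, let $s_i$ be the operator on subsets $S\subseteq\mathbb{Z}$ that, for every $x\in\mathbb{Z}$ with $x+1\equiv \pm i\pmod{2l}$, exchanges the membership of $x$ and $x+1$ in $S$, and leaves all other positions unchanged. These operators encode the simple reflections of the affine Weyl group of type $C_l^{(1)}$ acting on abaci. $(\lambda,j)$ is a $j$-core abacus of type $C_l^{(1)}$ if $\beta_j(\lambda)$ lies in the orbit of $\mathbb{Z}_{<j}$ under the group generated by $s_0,\dots,s_l$. -}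

module Defs where

open import Data.Nat as ℕ using (ℕ; zero; suc)
open import Data.Integer as ℤ using (ℤ; +_; _+_; _-_; _<_)
open import Data.Integer.Divisibility using (_∣_)
open import Data.Fin using (Fin; toℕ)
open import Data.List using (List; []; _∷_; foldr)
open import Data.List.Relation.Unary.All using (All)
open import Data.List.Relation.Unary.Linked using (Linked)
open import Data.Product using (Σ; _×_; ∃)
open import Data.Sum using (_⊎_)
open import Relation.Nullary using (¬_)
open import Relation.Binary.PropositionalEquality using (_≡_)
open import Function.Bundles using (_⇔_)

record Partition : Set where
  field
    parts    : List ℕ
    nonincr  : Linked ℕ._≥_ parts
    positive : All (λ p → 0 ℕ.< p) parts
open Partition public

-- λ_i for i ≥ 1 (here indexed from 0: part 0 = λ_1), 0 beyond the length.
part : Partition → ℕ → ℕ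
part p n = go (parts p) n
  where
  go : List ℕ → ℕ → ℕ
  go []       _       = 0
  go (x ∷ _)  zero    = x
  go (_ ∷ xs) (suc k) = go xs k

ZSet : Set₁
ZSet = ℤ → Set

β : ℤ → Partition → ZSet
β j p x = ∃ λ (n : ℕ) → x ≡ (+ part p n - + suc n) + j

≡±mod : ℕ → ℕ → ℤ → Set
≡±mod l i y = ((+ (2 ℕ.* l)) ∣ (y - + i)) ⊎ ((+ (2 ℕ.* l)) ∣ (y + + i))

-- The operator s_i: swaps membership of x and x+1 whenever x+1 ≡ ±i (mod 2l).
-- (For 0 ≤ i ≤ l these transpositions are pairwise disjoint.)
s : (l i : ℕ) → ZSet → ZSet
s l i S x =
    (≡±mod l i (x + + 1) × S (x + + 1))
  ⊎ (≡±mod l i x × S (x - + 1))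
  ⊎ (¬ ≡±mod l i (x + + 1) × ¬ ≡±mod l i x × S x)

-- Action of a word in the generators s_0, …, s_l (rightmost letter applied first).
act : (l : ℕ) → List (Fin (suc l)) → ZSet → ZSet
act l w S = foldr (λ i T → s l (toℕ i) T) S w

below : ℤ → ZSet
below j x = x < j

-- (λ, j) is a j-core abacus of type C_l^(1): β_j(λ) lies in the orbit of ℤ_{<j}
-- under the group generated by s_0,…,s_l (each s_i is an involution, so words suffice).
IsCoreAbacus : ℕ → Partition → ℤ → Set
IsCoreAbacus l p j =
  ∃ λ (w : List (Fin (suc l))) → ∀ x → β j p x ⇔ act l w (below j) x

module Submission where

-- The window of 2l positions is exactly one period of the generators: each s_i
-- commutes with the shift x ↦ x - 2l, and ℤ_{<j} is closed under that shift, so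
-- every abacus in the orbit is closed under it too. Hence a bead at x forces beads
-- at x - 2l, x - 4l, …; an empty window of length 2l therefore stays empty when
-- slid upwards, and a full window stays full when slid downwards.

open import Defs
open import Data.Nat as ℕ using (ℕ; suc; s≤s)
open import Data.Integer as ℤ using (ℤ; +_; _+_; _-_; _<_; _≤_; ∣_∣)
open import Data.Integer.Divisibility using (_∣_)
open import Data.Integer.Tactic.RingSolver using (solve-∀)
open import Data.Product using (_×_; ∃; _,_)
open import Data.Sum using (inj₁; inj₂)
open import Data.List using ([]; _∷_)
open import Data.Fin using (toℕ)
open import Function.Bundles using (_⇔_; mk⇔; Equivalence)
open import Relation.Nullary using (¬_)
open import Relation.Binary.PropositionalEquality using (_≡_; sym; subst)
import Data.Integer.Properties as ℤ
import Data.Integer.Divisibility.Signed as Signed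
import Data.Nat.Properties as ℕ

ClosedUnderShiftDown : ℤ → ZSet → Set
ClosedUnderShiftDown n S = ∀ x → S x → S (x - n)

n∣m⇔n∣m-n : ∀ n m → (n ∣ m) ⇔ (n ∣ m - n)
n∣m⇔n∣m-n n m = mk⇔
  (λ n∣m → Signed.∣⇒∣ᵤ
    (Signed.∣m∣n⇒∣m-n (Signed.∣ᵤ⇒∣ {n} {m} n∣m) Signed.∣-refl))
  (λ n∣m-n → Signed.∣⇒∣ᵤ {n} {m}
    (Signed.∣m+n∣n⇒∣m (Signed.∣ᵤ⇒∣ {n} {m - n} n∣m-n)
                      (Signed.∣m⇒∣-m Signed.∣-refl)))

module _ (l i : ℕ) where
  open Equivalence

  private
    period : ℤ
    period = + (2 ℕ.* l)

    succ-shift : ∀ x n → (x + + 1) - n ≡ (x - n) + + 1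
    succ-shift = solve-∀

    pred-shift : ∀ x n → (x - + 1) - n ≡ (x - n) - + 1
    pred-shift = solve-∀

    minus-swap : ∀ y i n → (y - i) - n ≡ (y - n) - i
    minus-swap = solve-∀

    plus-swap : ∀ y i n → (y + i) - n ≡ (y - n) + i
    plus-swap = solve-∀

  ≡±mod-periodic : ∀ y → ≡±mod l i y ⇔ ≡±mod l i (y - period)
  ≡±mod-periodic y = mk⇔
    (λ { (inj₁ d) → inj₁ (subst (period ∣_) (minus-swap y (+ i) period)
                                (to (n∣m⇔n∣m-n period (y - + i)) d))
       ; (inj₂ d) → inj₂ (subst (period ∣_) (plus-swap y (+ i) period)
                                (to (n∣m⇔n∣m-n period (y + + i)) d)) })
    (λ { (inj₁ d) → inj₁ (from (n∣m⇔n∣m-n period (y - + i))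
                               (subst (period ∣_) (sym (minus-swap y (+ i) period)) d))
       ; (inj₂ d) → inj₂ (from (n∣m⇔n∣m-n period (y + + i))
                               (subst (period ∣_) (sym (plus-swap y (+ i) period)) d)) })

  s-closedUnderShiftDown : ∀ S → ClosedUnderShiftDown period S →
                           ClosedUnderShiftDown period (s l i S)
  s-closedUnderShiftDown S closed x (inj₁ (x+1≡± , Sx+1)) =
    inj₁ ( subst (≡±mod l i) (succ-shift x period) (to (≡±mod-periodic (x + + 1)) x+1≡±)
         , subst S (succ-shift x period) (closed _ Sx+1))
  s-closedUnderShiftDown S closed x (inj₂ (inj₁ (x≡± , Sx-1))) =
    inj₂ (inj₁ ( to (≡±mod-periodic x) x≡±
               , subst S (pred-shift x period) (closed _ Sx-1)))
  s-closedUnderShiftDown S closed x (inj₂ (inj₂ (x+1≢± , x≢± , Sx))) =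
    inj₂ (inj₂ ( (λ x-n+1≡± → x+1≢± (from (≡±mod-periodic (x + + 1))
                   (subst (≡±mod l i) (sym (succ-shift x period)) x-n+1≡±)))
               , (λ x-n≡± → x≢± (from (≡±mod-periodic x) x-n≡±))
               , closed x Sx))

act-closedUnderShiftDown : ∀ l w S → ClosedUnderShiftDown (+ (2 ℕ.* l)) S →
                           ClosedUnderShiftDown (+ (2 ℕ.* l)) (act l w S)
act-closedUnderShiftDown l []      S closed = closed
act-closedUnderShiftDown l (i ∷ w) S closed =
  s-closedUnderShiftDown l (toℕ i) (act l w S) (act-closedUnderShiftDown l w S closed)

below-closedUnderShiftDown : ∀ n j → ClosedUnderShiftDown (+ n) (below j)
below-closedUnderShiftDown n j x x<j = ℤ.≤-<-trans (ℤ.i-j≤i x (+ n)) x<j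

coreAbacus-closedUnderShiftDown : ∀ l p j → IsCoreAbacus l p j →
                                  ClosedUnderShiftDown (+ (2 ℕ.* l)) (β j p)
coreAbacus-closedUnderShiftDown l p j (w , β⇔orbit) x bead =
  from (β⇔orbit _)
    (act-closedUnderShiftDown l w (below j) (below-closedUnderShiftDown _ j) x
      (to (β⇔orbit x) bead))
  where open Equivalence

module Windows {S : ZSet} (n : ℕ) (closed : ClosedUnderShiftDown (+ suc n) S) where

  EmptyWindowBelow : ℤ → Set
  EmptyWindowBelow m = ∀ k → k ℕ.< suc n → ¬ S (m - + k)

  FullWindowAbove : ℤ → Set
  FullWindowAbove m = ∀ k → k ℕ.< suc n → S (m + + k)

  emptyWindow-slideUp : ∀ m → EmptyWindowBelow m → EmptyWindowBelow (m + + 1)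
  emptyWindow-slideUp m empty 0 _ Sm+1 =
    empty n ℕ.≤-refl
      (subst S (wrap m (+ n)) (closed (m + + 1) (subst S (ℤ.+-identityʳ (m + + 1)) Sm+1)))
    where
    wrap : ∀ m n → (m + + 1) - (+ 1 + n) ≡ m - n
    wrap = solve-∀
  emptyWindow-slideUp m empty (suc k) (s≤s k<n) Sm+1-k =
    empty k (ℕ.m≤n⇒m≤1+n k<n) (subst S (unshift m (+ k)) Sm+1-k)
    where
    unshift : ∀ m k → (m + + 1) - (+ 1 + k) ≡ m - k
    unshift = solve-∀

  fullWindow-slideDown : ∀ m → FullWindowAbove m → FullWindowAbove (m - + 1)
  fullWindow-slideDown m full 0 _ =
    subst S (wrap m (+ n)) (closed _ (full n ℕ.≤-refl))
    where
    wrap : ∀ m n → (m + n) - (+ 1 + n) ≡ (m - + 1) + + 0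
    wrap = solve-∀
  fullWindow-slideDown m full (suc k) (s≤s k<n) =
    subst S (unshift m (+ k)) (full k (ℕ.m≤n⇒m≤1+n k<n))
    where
    unshift : ∀ m k → m + k ≡ (m - + 1) + (+ 1 + k)
    unshift = solve-∀

  emptyWindow⇒empty-above : ∀ m → EmptyWindowBelow m → ∀ d → ¬ S (m + + d)
  emptyWindow⇒empty-above m empty d bead =
    slid d 0 ℕ.z<s (subst S (sym (ℤ.+-identityʳ _)) bead)
    where
    slid : ∀ d → EmptyWindowBelow (m + + d)
    slid 0       = subst EmptyWindowBelow (sym (ℤ.+-identityʳ m)) empty
    slid (suc d) =
      subst EmptyWindowBelow (shift-succ m (+ d)) (emptyWindow-slideUp (m + + d) (slid d))
      where
      shift-succ : ∀ m d → (m + d) + + 1 ≡ m + (+ 1 + d)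
      shift-succ = solve-∀

  fullWindow⇒full-below : ∀ m → FullWindowAbove m → ∀ d → S (m - + d)
  fullWindow⇒full-below m full d = subst S (ℤ.+-identityʳ _) (slid d 0 ℕ.z<s)
    where
    slid : ∀ d → FullWindowAbove (m - + d)
    slid 0       = subst FullWindowAbove (sym (ℤ.+-identityʳ m)) full
    slid (suc d) =
      subst FullWindowAbove (shift-succ m (+ d)) (fullWindow-slideDown (m - + d) (slid d))
      where
      shift-succ : ∀ m d → (m - d) - + 1 ≡ m - (+ 1 + d)
      shift-succ = solve-∀

≤⇒≡+∣-∣ : ∀ {m x} → m ≤ x → x ≡ m + + ∣ x - m ∣
≤⇒≡+∣-∣ {m} {x} m≤x
  rewrite ℤ.0≤i⇒+∣i∣≡i (ℤ.i≤j⇒0≤j-i m≤x) = sym (cancel m x)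
  where
  cancel : ∀ m x → m + (x - m) ≡ x
  cancel = solve-∀

≤⇒≡-∣-∣ : ∀ {x m} → x ≤ m → x ≡ m - + ∣ m - x ∣
≤⇒≡-∣-∣ {x} {m} x≤m
  rewrite ℤ.0≤i⇒+∣i∣≡i (ℤ.i≤j⇒0≤j-i x≤m) = sym (cancel m x)
  where
  cancel : ∀ m x → m - (m - x) ≡ x
  cancel = solve-∀

-- The hypothesis 2 ≤ l is only needed in the weaker form l ≥ 1, so that the window is nonempty.
corollary3p16 : (l : ℕ) → 2 ℕ.≤ l → (j : ℤ) (p : Partition) → IsCoreAbacus l p j →
    ((i : ℤ) → β j p i →
    ¬ (∃ λ (m : ℤ) → m < i × ((k : ℕ) → k ℕ.< 2 ℕ.* l → ¬ β j p (m - + k))))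
    × ((i : ℤ) → ¬ β j p i →
    ¬ (∃ λ (m : ℤ) → i < m × ((k : ℕ) → k ℕ.< 2 ℕ.* l → β j p (m + + k))))
corollary3p16 l@(suc _) _ j p core =
    (λ i bead (m , m<i , gap) →
      emptyWindow⇒empty-above m gap _ (subst (β j p) (≤⇒≡+∣-∣ (ℤ.<⇒≤ m<i)) bead))
  , (λ i hole (m , i<m , run) →
      hole (subst (β j p) (sym (≤⇒≡-∣-∣ (ℤ.<⇒≤ i<m)))
                 (fullWindow⇒full-below m run _)))
  where open Windows _ (coreAbacus-closedUnderShiftDown l p j core)
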